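{- If $\Theta\vdash_{STA} M:\mu$ is derivable in the Soft Type Assignment system STA, then $[\Theta]\vdash M:[\mu]$ is derivable in STR.
   Context: Terms: $M ::= x \mid \lambda x.M \mid MM$ modulo $\alpha$-equivalence. STA types: linear $U ::= a \mid \mu\multimap U \mid \forall a.U$, modal $\mu ::= U \mid\ !\mu$. STA rules ($U$ linear): (Ax) $x:U\vdash x:U$; (w) from $\Theta\vdash M:\mu$, $x\notin dom(\Theta)$, infer $\Theta,x:U\vdash M:\mu$; ($\multimap$I) from $\Theta,x:\mu\vdash M:U$ infer $\Theta\vdash\lambda x.M:\mu\multimap U$; ($\multimap$E) from $\Theta\vdash M:\mu\multimap U$ and $\Xi\vdash N:\mu$ with disjoint domains infer $\Theta,\Xi\vdash MN:U$; ($\forall$I) from $\Theta\vdash M:U$, $a$ not free in $\Theta$, infer $\Theta\vdash M:\forall a.U$; ($\forall$E) from $\Theta\vdash M:\forall a.B$ infer $\Theta\vdash M:B[U/a]$; (m) from $\Theta,x_1:\mu,\dots,x_n:\mu\vdash M:\nu$ infer $\Theta,x:!\mu\vdash M[x/x_1,\dots,x/x_n]:\nu$; (sp) from $\Theta\vdash M:\mu$ infer $!\Theta\vdash M:!\mu$ (prefixing every type in the context by $!$). STR types: linear $A ::= a \mid \sigma\multimap A \mid \forall a.A$, stratified $\sigma ::= A \mid \{\sigma_1,\dots,\sigma_n\}$ ($n\ge1$), modulo renaming of bound type variables and the congruence treating $\{\sigma_1,\dots,\sigma_n\}$ as a finite set. STR rules ($A,B$ linear): (Ax) $x:A\vdash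 x:A$; (w) from $\Gamma\vdash M:\sigma$, $x\notin dom(\Gamma)$, infer $\Gamma,x:A\vdash M:\sigma$; ($\multimap$I) from $\Gamma,x:\sigma\vdash M:B$ infer $\Gamma\vdash\lambda x.M:\sigma\multimap B$; ($\multimap$E) from $\Gamma_1\vdash M:\sigma\multimap A$, $\Gamma_2\vdash N:\sigma$ with disjoint domains infer $\Gamma_1,\Gamma_2\vdash MN:A$; (m) from $\Gamma,x_1:\sigma_1,\dots,x_n:\sigma_n\vdash M:\tau$ infer $\Gamma,x:\{\sigma_1,\dots,\sigma_n\}\vdash M[x/x_1,\dots,x/x_n]:\tau$; (st) from $\Gamma_i\vdash M:\sigma_i$ ($1\le i\le n$), all $\Gamma_i$ with the same domain, infer $\bigcup_i\{\Gamma_i\}\vdash M:\{\sigma_1,\dots,\sigma_n\}$, where $(\bigcup_i\{\Gamma_i\})(x)=\{\Gamma_1(x),\dots,\Gamma_n(x)\}$; ($\forall$I) from $\Gamma\vdash M:A$, $a$ not free in $\Gamma$, infer $\Gamma\vdash M:\forall a.A$; ($\forall$E) from $\Gamma\vdash M:\forall a.B$ infer $\Gamma\vdash M:B[A/a]$, $A$ linear. Translation: $[a]=a$, $[\mu\multimap U]=[\mu]\multimap[U]$, $[\forall a.U]=\forall a.[U]$, $[!\mu]=\{[\mu]\}$; $[\Theta](x)=[\Theta(x)]$. -}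

module Defs where

open import Data.Nat using (ℕ; zero; suc; _≡ᵇ_; _<ᵇ_; pred)
open import Data.Bool using (Bool; true; false; if_then_else_; _∨_)
open import Data.Empty using (⊥)
open import Data.Unit using (⊤)
open import Data.Maybe using (Maybe; just; nothing; _<∣>_)
import Data.Maybe as Maybe
open import Data.Product using (_×_; _,_; proj₁; proj₂; Σ)
open import Data.Sum using (_⊎_)
open import Data.Fin using (Fin)
import Data.Fin as Fin
open import Data.List using (List; []; _∷_; foldr)
import Data.List as List
open import Data.List.NonEmpty using (List⁺; _∷_; toList)
import Data.List.NonEmpty as List⁺
open import Data.List.Relation.Unary.All using (All)
open import Data.List.Relation.Unary.Any using (Any)
open import Data.List.Relation.Unary.Unique.Propositional using (Unique)
open import Relation.Binary.PropositionalEquality using (_≡_; _≢_)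
open import Relation.Nullary using (¬_)

Var : Set
Var = ℕ

data Term : Set where
  var : Var → Term
  lam : Var → Term → Term
  app : Term → Term → Term

swapVar : Var → Var → Var → Var
swapVar a b c = if c ≡ᵇ a then b else (if c ≡ᵇ b then a else c)

swap : Var → Var → Term → Term
swap a b (var c)   = var (swapVar a b c)
swap a b (lam c M) = lam (swapVar a b c) (swap a b M)
swap a b (app M N) = app (swap a b M) (swap a b N)

data Occurs (z : Var) : Term → Set where
  var  : Occurs z (var z)
  bnd  : ∀ {M} → Occurs z (lam z M)
  lam  : ∀ {y M} → Occurs z M → Occurs z (lam y M)
  appˡ : ∀ {M N} → Occurs z M → Occurs z (app M N)
  appʳ : ∀ {M N} → Occurs z N → Occurs z (app M N)

data Binds (z : Var) : Term → Set where
  here : ∀ {M} → Binds z (lam z M)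
  lam  : ∀ {y M} → Binds z M → Binds z (lam y M)
  appˡ : ∀ {M N} → Binds z M → Binds z (app M N)
  appʳ : ∀ {M N} → Binds z N → Binds z (app M N)

data _=α_ : Term → Term → Set where
  var : ∀ x → var x =α var x
  app : ∀ {M M' N N'} → M =α M' → N =α N' → app M N =α app M' N'
  lam : ∀ {x y M N} (z : Var) →
        ¬ Occurs z (lam x M) → ¬ Occurs z (lam y N) →
        swap x z M =α swap y z N → lam x M =α lam y N

-- renaming of the free occurrences of y by x:  M[x/y]
rename : Var → Var → Term → Term
rename y x (var z)   = if z ≡ᵇ y then var x else var z
rename y x (lam z M) = if z ≡ᵇ y then lam z M else lam z (rename y x M)
rename y x (app M N) = app (rename y x M) (rename y x N)

renameAll : List Var → Var → Term → Term
renameAll ys x M = foldr (λ y N → rename y x N) M ys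

Ctx : Set → Set
Ctx T = Var → Maybe T

_≐_ : ∀ {T} → Ctx T → Ctx T → Set
Γ ≐ Δ = ∀ y → Γ y ≡ Δ y

single : ∀ {T} → Var → T → Ctx T
single x t y = if y ≡ᵇ x then just t else nothing

extend : ∀ {T} → Ctx T → Var → T → Ctx T
extend Γ x t y = if y ≡ᵇ x then just t else Γ y

extendMany : ∀ {T} → Ctx T → List (Var × T) → Ctx T
extendMany Γ bs = foldr (λ b Δ → extend Δ (proj₁ b) (proj₂ b)) Γ bs

Disjoint : ∀ {T} → Ctx T → Ctx T → Set
Disjoint Γ Δ = ∀ y → Γ y ≡ nothing ⊎ Δ y ≡ nothing

-- Γ , Δ (for disjoint domains)
union : ∀ {T} → Ctx T → Ctx T → Ctx T
union Γ Δ y = Γ y <∣> Δ y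

mapCtx : ∀ {S T} → (S → T) → Ctx S → Ctx T
mapCtx f Γ y = Maybe.map f (Γ y)

data IsJust {A : Set} : Maybe A → Set where
  isJust : ∀ x → IsJust (just x)

SameDomain : ∀ {S T} → Ctx S → Ctx T → Set
SameDomain Γ Δ = ∀ y → (IsJust (Γ y) → IsJust (Δ y)) × (IsJust (Δ y) → IsJust (Γ y))

-- de Bruijn index operations on type variables
-- (types are identified up to renaming of bound type variables)

shiftVar : ℕ → ℕ → ℕ
shiftVar c i = if i <ᵇ c then i else suc i

mutual
  data LinA : Set where
    tvar : ℕ → LinA
    _⊸_  : ModA → LinA → LinA
    ∀'   : LinA → LinA

  data ModA : Set where
    lin : LinA → ModA
    !_  : ModA → ModA

mutual
  shiftLA : ℕ → LinA → LinA
  shiftLA c (tvar i) = tvar (shiftVar c i)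
  shiftLA c (μ ⊸ U)  = shiftMA c μ ⊸ shiftLA c U
  shiftLA c (∀' U)   = ∀' (shiftLA (suc c) U)

  shiftMA : ℕ → ModA → ModA
  shiftMA c (lin U) = lin (shiftLA c U)
  shiftMA c (! μ)   = ! shiftMA c μ

-- substitution of type variable j by a linear type (with lowering of
-- the variables above j):  B[U/a]  is  substLA 0 U B  for B = ∀ a . …
mutual
  substLA : ℕ → LinA → LinA → LinA
  substLA j V (tvar i) = if i ≡ᵇ j then V else (if j <ᵇ i then tvar (pred i) else tvar i)
  substLA j V (μ ⊸ U)  = substMA j V μ ⊸ substLA j V U
  substLA j V (∀' U)   = ∀' (substLA (suc j) (shiftLA 0 V) U)

  substMA : ℕ → LinA → ModA → ModA
  substMA j V (lin U) = lin (substLA j V U)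
  substMA j V (! μ)   = ! substMA j V μ

mutual
  data LinR : Set where
    tvar : ℕ → LinR
    _⊸_  : StR → LinR → LinR
    ∀'   : LinR → LinR

  -- stratified types σ ;  set S  is  {σ₁,…,σₙ} , n ≥ 1
  data StR : Set where
    lin : LinR → StR
    set : List⁺ StR → StR

mutual
  shiftLR : ℕ → LinR → LinR
  shiftLR c (tvar i) = tvar (shiftVar c i)
  shiftLR c (σ ⊸ A)  = shiftSR c σ ⊸ shiftLR c A
  shiftLR c (∀' A)   = ∀' (shiftLR (suc c) A)

  shiftSR : ℕ → StR → StR
  shiftSR c (lin A)      = lin (shiftLR c A)
  shiftSR c (set (σ ∷ σs)) = set (shiftSR c σ ∷ shiftListR c σs)

  shiftListR : ℕ → List StR → List StR
  shiftListR c []       = []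
  shiftListR c (σ ∷ σs) = shiftSR c σ ∷ shiftListR c σs

mutual
  substLR : ℕ → LinR → LinR → LinR
  substLR j V (tvar i) = if i ≡ᵇ j then V else (if j <ᵇ i then tvar (pred i) else tvar i)
  substLR j V (σ ⊸ A)  = substSR j V σ ⊸ substLR j V A
  substLR j V (∀' A)   = ∀' (substLR (suc j) (shiftLR 0 V) A)

  substSR : ℕ → LinR → StR → StR
  substSR j V (lin A)        = lin (substLR j V A)
  substSR j V (set (σ ∷ σs)) = set (substSR j V σ ∷ substListR j V σs)

  substListR : ℕ → LinR → List StR → List StR
  substListR j V []       = []
  substListR j V (σ ∷ σs) = substSR j V σ ∷ substListR j V σs

-- the congruence treating {σ₁,…,σₙ} as a finite set
mutual
  data _≈L_ : LinR → LinR → Set where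
    tvar : ∀ i → tvar i ≈L tvar i
    arr  : ∀ {σ σ' A A'} → σ ≈S σ' → A ≈L A' → (σ ⊸ A) ≈L (σ' ⊸ A')
    all  : ∀ {A A'} → A ≈L A' → ∀' A ≈L ∀' A'

  data _≈S_ : StR → StR → Set where
    lin : ∀ {A A'} → A ≈L A' → lin A ≈S lin A'
    set : ∀ {S T} →
          All (λ s → Any (λ t → s ≈S t) (toList T)) (toList S) →
          All (λ t → Any (λ s → s ≈S t) (toList S)) (toList T) →
          set S ≈S set T

_≈C_ : Ctx StR → Ctx StR → Set
Γ ≈C Δ = ∀ y → (Γ y ≡ nothing × Δ y ≡ nothing)
             ⊎ Σ StR (λ σ → Σ StR (λ τ → Γ y ≡ just σ × Δ y ≡ just τ × σ ≈S τ))

infix 4 _⊢A_∶_ _⊢R_∶_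

data _⊢A_∶_ : Ctx ModA → Term → ModA → Set where
  ax  : ∀ {Θ x U} → Θ ≐ single x (lin U) → Θ ⊢A var x ∶ lin U
  w   : ∀ {Θ Θ' M μ x U} → Θ ⊢A M ∶ μ → Θ x ≡ nothing →
        Θ' ≐ extend Θ x (lin U) → Θ' ⊢A M ∶ μ
  ⊸I  : ∀ {Θ x M μ U} → Θ x ≡ nothing → extend Θ x μ ⊢A M ∶ lin U →
        Θ ⊢A lam x M ∶ lin (μ ⊸ U)
  ⊸E  : ∀ {Θ Ξ Δ M N μ U} → Θ ⊢A M ∶ lin (μ ⊸ U) → Ξ ⊢A N ∶ μ →
        Disjoint Θ Ξ → Δ ≐ union Θ Ξ → Δ ⊢A app M N ∶ lin U
  -- a not free in Θ : premise context is Θ with its free type variables shifted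
  ∀I  : ∀ {Θ M U} → mapCtx (shiftMA 0) Θ ⊢A M ∶ lin U → Θ ⊢A M ∶ lin (∀' U)
  ∀E  : ∀ {Θ M B} (U : LinA) → Θ ⊢A M ∶ lin (∀' B) → Θ ⊢A M ∶ lin (substLA 0 U B)
  -- (m), n ≥ 1, x₁,…,xₙ distinct and not in dom Θ; x not in dom Θ;
  -- x not bound in M, so that M[x/x₁,…,x/xₙ] is capture-free
  m   : ∀ {Θ Δ M μ ν} (xs : List⁺ Var) (x : Var) →
        Unique (toList xs) → All (λ y → Θ y ≡ nothing) (toList xs) →
        Θ x ≡ nothing → ¬ Binds x M →
        extendMany Θ (List.map (λ y → y , μ) (toList xs)) ⊢A M ∶ ν →
        Δ ≐ extend Θ x (! μ) → Δ ⊢A renameAll (toList xs) x M ∶ ν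
  sp  : ∀ {Θ Δ M μ} → Θ ⊢A M ∶ μ → Δ ≐ mapCtx !_ Θ → Δ ⊢A M ∶ ! μ
  -- terms are taken modulo α-equivalence
  α   : ∀ {Θ M N μ} → Θ ⊢A M ∶ μ → M =α N → Θ ⊢A N ∶ μ

tab⁺ : ∀ {A : Set} k → (Fin (suc k) → A) → List⁺ A
tab⁺ k f = f Fin.zero ∷ List.tabulate (λ i → f (Fin.suc i))

-- Δ = ⋃ᵢ {Γᵢ}
StUnion : ∀ k → (Fin (suc k) → Ctx StR) → Ctx StR → Set
StUnion k Γs Δ = ∀ y → (Δ y ≡ nothing × (∀ i → Γs i y ≡ nothing))
  ⊎ Σ (Fin (suc k) → StR) (λ τs → (∀ i → Γs i y ≡ just (τs i)) × Δ y ≡ just (set (tab⁺ k τs)))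

data _⊢R_∶_ : Ctx StR → Term → StR → Set where
  ax  : ∀ {Γ x A} → Γ ≐ single x (lin A) → Γ ⊢R var x ∶ lin A
  w   : ∀ {Γ Γ' M σ x A} → Γ ⊢R M ∶ σ → Γ x ≡ nothing →
        Γ' ≐ extend Γ x (lin A) → Γ' ⊢R M ∶ σ
  ⊸I  : ∀ {Γ x M σ B} → Γ x ≡ nothing → extend Γ x σ ⊢R M ∶ lin B →
        Γ ⊢R lam x M ∶ lin (σ ⊸ B)
  ⊸E  : ∀ {Γ₁ Γ₂ Δ M N σ A} → Γ₁ ⊢R M ∶ lin (σ ⊸ A) → Γ₂ ⊢R N ∶ σ →
        Disjoint Γ₁ Γ₂ → Δ ≐ union Γ₁ Γ₂ → Δ ⊢R app M N ∶ lin A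
  m   : ∀ {Γ Δ M τ} (bs : List⁺ (Var × StR)) (x : Var) →
        Unique (List.map proj₁ (toList bs)) →
        All (λ b → Γ (proj₁ b) ≡ nothing) (toList bs) →
        Γ x ≡ nothing → ¬ Binds x M →
        extendMany Γ (toList bs) ⊢R M ∶ τ →
        Δ ≐ extend Γ x (set (List⁺.map proj₂ bs)) →
        Δ ⊢R renameAll (List.map proj₁ (toList bs)) x M ∶ τ
  st  : ∀ {Δ M} k (Γs : Fin (suc k) → Ctx StR) (σs : Fin (suc k) → StR) →
        (∀ i → Γs i ⊢R M ∶ σs i) →
        (∀ i j → SameDomain (Γs i) (Γs j)) →
        StUnion k Γs Δ → Δ ⊢R M ∶ set (tab⁺ k σs)
  ∀I  : ∀ {Γ M A} → mapCtx (shiftSR 0) Γ ⊢R M ∶ lin A → Γ ⊢R M ∶ lin (∀' A)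
  ∀E  : ∀ {Γ M B} (A : LinR) → Γ ⊢R M ∶ lin (∀' B) → Γ ⊢R M ∶ lin (substLR 0 A B)
  α   : ∀ {Γ M N σ} → Γ ⊢R M ∶ σ → M =α N → Γ ⊢R N ∶ σ
  -- types modulo the finite-set congruence
  cong≈ : ∀ {Γ Γ' M σ σ'} → Γ ⊢R M ∶ σ → Γ ≈C Γ' → σ ≈S σ' → Γ' ⊢R M ∶ σ'

mutual
  trL : LinA → LinR
  trL (tvar a) = tvar a
  trL (μ ⊸ U)  = trM μ ⊸ trL U
  trL (∀' U)   = ∀' (trL U)

  trM : ModA → StR
  trM (lin U) = lin (trL U)
  trM (! μ)   = set (trM μ ∷ [])

trCtx : Ctx ModA → Ctx StR
trCtx Θ = mapCtx trM Θ

module Submission where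

open import Defs
open import Data.Nat using (suc; _≡ᵇ_; _<ᵇ_)
open import Data.Bool using (true; false)
open import Data.Maybe using (Maybe; just; nothing)
import Data.Maybe as Maybe
open import Data.Product using (_×_; _,_; proj₁; proj₂; Σ)
open import Data.Sum using (_⊎_; inj₁; inj₂)
open import Data.List using (List; []; _∷_)
import Data.List as List
open import Data.List.Properties using (map-∘; map-id)
open import Data.List.NonEmpty using (List⁺; _∷_; toList)
import Data.List.NonEmpty as List⁺
open import Data.List.Relation.Unary.All using (All; []; _∷_; universal)
import Data.List.Relation.Unary.All as All
open import Data.List.Relation.Unary.All.Properties using (map⁺)
open import Data.List.Relation.Unary.Any using (Any; here; there)
open import Data.List.Relation.Unary.Unique.Propositional using (Unique)
open import Relation.Binary.PropositionalEquality
  using (_≡_; refl; sym; trans; cong; cong₂; subst)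
open import Relation.Nullary using (¬_)

≐-trans : ∀ {T} {Γ Δ Ξ : Ctx T} → Γ ≐ Δ → Δ ≐ Ξ → Γ ≐ Ξ
≐-trans p q y = trans (p y) (q y)

≐-sym : ∀ {T} {Γ Δ : Ctx T} → Γ ≐ Δ → Δ ≐ Γ
≐-sym p y = sym (p y)

mapCtx-cong : ∀ {S T} (f : S → T) {Γ Δ : Ctx S} → Γ ≐ Δ → mapCtx f Γ ≐ mapCtx f Δ
mapCtx-cong f e y = cong (Maybe.map f) (e y)

extend-cong : ∀ {T} {Γ Δ : Ctx T} x t → Γ ≐ Δ → extend Γ x t ≐ extend Δ x t
extend-cong x t e y with y ≡ᵇ x
... | true  = refl
... | false = e y

mapCtx-square : ∀ {R S S' T} {f : S → T} {g : R → S} {h : S' → T} {k : R → S'} →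
  (∀ r → f (g r) ≡ h (k r)) → (Γ : Ctx R) → mapCtx f (mapCtx g Γ) ≐ mapCtx h (mapCtx k Γ)
mapCtx-square comm Γ y with Γ y
... | nothing = refl
... | just r  = cong just (comm r)

mapCtx-single : ∀ {S T} (f : S → T) x t → mapCtx f (single x t) ≐ single x (f t)
mapCtx-single f x t y with y ≡ᵇ x
... | true  = refl
... | false = refl

mapCtx-extend : ∀ {S T} (f : S → T) Γ x t →
  mapCtx f (extend Γ x t) ≐ extend (mapCtx f Γ) x (f t)
mapCtx-extend f Γ x t y with y ≡ᵇ x
... | true  = refl
... | false = refl

mapCtx-extendMany : ∀ {S T} (f : S → T) Γ t ys →
  mapCtx f (extendMany Γ (List.map (λ y → y , t) ys))
    ≐ extendMany (mapCtx f Γ) (List.map (λ y → y , f t) ys)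
mapCtx-extendMany f Γ t []       = λ _ → refl
mapCtx-extendMany f Γ t (z ∷ ys) =
  ≐-trans (mapCtx-extend f _ z t) (extend-cong z (f t) (mapCtx-extendMany f Γ t ys))

mapCtx-union : ∀ {S T} (f : S → T) Γ Δ →
  mapCtx f (union Γ Δ) ≐ union (mapCtx f Γ) (mapCtx f Δ)
mapCtx-union f Γ Δ y with Γ y
... | nothing = refl
... | just _  = refl

mapCtx-disjoint : ∀ {S T} (f : S → T) {Γ Δ} → Disjoint Γ Δ →
  Disjoint (mapCtx f Γ) (mapCtx f Δ)
mapCtx-disjoint f d y with d y
... | inj₁ p = inj₁ (cong (Maybe.map f) p)
... | inj₂ p = inj₂ (cong (Maybe.map f) p)

mapCtx-fresh : ∀ {S T} (f : S → T) (Γ : Ctx S) {x} → Γ x ≡ nothing → mapCtx f Γ x ≡ nothing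
mapCtx-fresh f Γ p = cong (Maybe.map f) p

diagonal : ∀ {R : StR → StR → Set} σs → All (λ s → R s s) σs → All (λ s → Any (R s) σs) σs
diagonal []       []       = []
diagonal (σ ∷ σs) (r ∷ rs) = here r ∷ All.map there (diagonal σs rs)

mutual
  ≈L-refl : ∀ A → A ≈L A
  ≈L-refl (tvar i) = tvar i
  ≈L-refl (σ ⊸ A)  = arr (≈S-refl σ) (≈L-refl A)
  ≈L-refl (∀' A)   = all (≈L-refl A)

  ≈S-refl : ∀ σ → σ ≈S σ
  ≈S-refl (lin A)        = lin (≈L-refl A)
  ≈S-refl (set (σ ∷ σs)) = set (diagonal (σ ∷ σs) (≈S-refl σ ∷ ≈S-refl-all σs))
                               (diagonal (σ ∷ σs) (≈S-refl σ ∷ ≈S-refl-all σs))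

  ≈S-refl-all : ∀ σs → All (λ s → s ≈S s) σs
  ≈S-refl-all []       = []
  ≈S-refl-all (σ ∷ σs) = ≈S-refl σ ∷ ≈S-refl-all σs

≡⇒≈-at : (a b : Maybe StR) → a ≡ b →
  (a ≡ nothing × b ≡ nothing) ⊎ Σ StR (λ σ → Σ StR (λ τ → a ≡ just σ × b ≡ just τ × σ ≈S τ))
≡⇒≈-at nothing  .nothing  refl = inj₁ (refl , refl)
≡⇒≈-at (just σ) .(just σ) refl = inj₂ (σ , σ , refl , refl , ≈S-refl σ)

≐⇒≈C : ∀ {Γ Γ'} → Γ ≐ Γ' → Γ ≈C Γ'
≐⇒≈C {Γ} {Γ'} e y = ≡⇒≈-at (Γ y) (Γ' y) (e y)

extend-≈C : ∀ (Γ : Ctx StR) x {σ τ} → σ ≈S τ → extend Γ x σ ≈C extend Γ x τ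
extend-≈C Γ x {σ} {τ} p y with y ≡ᵇ x
... | true  = inj₂ (σ , τ , refl , refl , p)
... | false = ≡⇒≈-at (Γ y) (Γ y) refl

transport : ∀ {Γ Γ' M σ} → Γ ≐ Γ' → Γ ⊢R M ∶ σ → Γ' ⊢R M ∶ σ
transport {σ = σ} e d = cong≈ d (≐⇒≈C e) (≈S-refl σ)

singleton : StR → StR
singleton σ = set (σ ∷ [])

set-collapse : ∀ σ {σs} → All (λ s → s ≡ σ) σs → set (σ ∷ σs) ≈S singleton σ
set-collapse σ eqs = set (here (≈S-refl σ) ∷ All.map into-singleton eqs) (here (≈S-refl σ) ∷ [])
  where
  into-singleton : ∀ {s} → s ≡ σ → Any (λ t → s ≈S t) (σ ∷ [])
  into-singleton refl = here (≈S-refl σ)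

-- Derived STR rule: contraction (m) of variables ys that all have the same
-- type σ, producing the entry x : {σ}.  This is the image of STA's (m).
m-uniform : ∀ {Γ Δ M τ} σ (ys : List⁺ Var) x →
  Unique (toList ys) → All (λ y → Γ y ≡ nothing) (toList ys) →
  Γ x ≡ nothing → ¬ Binds x M →
  extendMany Γ (List.map (λ y → y , σ) (toList ys)) ⊢R M ∶ τ →
  Δ ≐ extend Γ x (singleton σ) → Δ ⊢R renameAll (toList ys) x M ∶ τ
m-uniform {Γ} {Δ} {M} {τ} σ ys x unique fresh x-fresh x-unbound d e =
  subst (λ zs → Δ ⊢R renameAll zs x M ∶ τ) names-tagged
    (transport (≐-sym e)
      (cong≈ contracted (extend-≈C Γ x (set-collapse σ types-tagged)) (≈S-refl τ)))
  where
  tagged : List⁺ (Var × StR)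
  tagged = List⁺.map (λ y → y , σ) ys

  names-tagged : List.map proj₁ (toList tagged) ≡ toList ys
  names-tagged = trans (sym (map-∘ (toList ys))) (map-id (toList ys))

  types-tagged : All (λ s → s ≡ σ) (List.map proj₂ (List.map (λ y → y , σ) (List⁺.tail ys)))
  types-tagged = map⁺ (map⁺ (universal (λ _ → refl) (List⁺.tail ys)))

  -- STR's own (m) rule, producing the entry x : {σ,…,σ}
  contracted : extend Γ x (set (List⁺.map proj₂ tagged))
                 ⊢R renameAll (List.map proj₁ (toList tagged)) x M ∶ τ
  contracted = m tagged x (subst Unique (sym names-tagged) unique) (map⁺ fresh)
                 x-fresh x-unbound d (λ _ → refl)

-- Derived STR rule: (st) with one premise, i.e. soft promotion.
st-single : ∀ {Γ Δ M σ} → Γ ⊢R M ∶ σ → Δ ≐ mapCtx singleton Γ → Δ ⊢R M ∶ singleton σ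
st-single {Γ} {Δ} {σ = σ} d e =
  st 0 (λ _ → Γ) (λ _ → σ) (λ _ → d) (λ _ _ _ → (λ p → p) , (λ p → p)) union-at
  where
  union-at : StUnion 0 (λ _ → Γ) Δ
  union-at y with Γ y | e y
  ... | nothing | p = inj₁ (p , λ _ → refl)
  ... | just τ  | p = inj₂ ((λ _ → τ) , (λ _ → refl) , p)

mutual
  trL-shift : ∀ c U → trL (shiftLA c U) ≡ shiftLR c (trL U)
  trL-shift c (tvar i) = refl
  trL-shift c (μ ⊸ U)  = cong₂ _⊸_ (trM-shift c μ) (trL-shift c U)
  trL-shift c (∀' U)   = cong ∀' (trL-shift (suc c) U)

  trM-shift : ∀ c μ → trM (shiftMA c μ) ≡ shiftSR c (trM μ)
  trM-shift c (lin U) = cong lin (trL-shift c U)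
  trM-shift c (! μ)   = cong singleton (trM-shift c μ)

mutual
  trL-subst : ∀ j V B → trL (substLA j V B) ≡ substLR j (trL V) (trL B)
  trL-subst j V (tvar i) with i ≡ᵇ j
  ... | true  = refl
  ... | false with j <ᵇ i
  ...   | true  = refl
  ...   | false = refl
  trL-subst j V (μ ⊸ U) = cong₂ _⊸_ (trM-subst j V μ) (trL-subst j V U)
  trL-subst j V (∀' U)  =
    cong ∀' (trans (trL-subst (suc j) (shiftLA 0 V) U)
                   (cong (λ W → substLR (suc j) W (trL U)) (trL-shift 0 V)))

  trM-subst : ∀ j V μ → trM (substMA j V μ) ≡ substSR j (trL V) (trM μ)
  trM-subst j V (lin U) = cong lin (trL-subst j V U)
  trM-subst j V (! μ)   = cong singleton (trM-subst j V μ)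

mainTheorem16 : ∀ {Θ M μ} → Θ ⊢A M ∶ μ → trCtx Θ ⊢R M ∶ trM μ
mainTheorem16 (ax {x = x} {U = U} e) =
  ax (≐-trans (mapCtx-cong trM e) (mapCtx-single trM x (lin U)))
mainTheorem16 (w {Θ = Θ} {x = x} {U = U} d fresh e) =
  w (mainTheorem16 d) (mapCtx-fresh trM Θ fresh)
    (≐-trans (mapCtx-cong trM e) (mapCtx-extend trM Θ x (lin U)))
mainTheorem16 (⊸I {Θ = Θ} {x = x} {μ = μ} fresh d) =
  ⊸I (mapCtx-fresh trM Θ fresh) (transport (mapCtx-extend trM Θ x μ) (mainTheorem16 d))
mainTheorem16 (⊸E {Θ = Θ} {Ξ = Ξ} d₁ d₂ disjoint e) =
  ⊸E (mainTheorem16 d₁) (mainTheorem16 d₂) (mapCtx-disjoint trM disjoint)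
     (≐-trans (mapCtx-cong trM e) (mapCtx-union trM Θ Ξ))
mainTheorem16 (∀I {Θ = Θ} d) =
  ∀I (transport (mapCtx-square (trM-shift 0) Θ) (mainTheorem16 d))
mainTheorem16 (∀E {Θ = Θ} {M = M} {B = B} U d) =
  subst (λ A → trCtx Θ ⊢R M ∶ lin A) (sym (trL-subst 0 U B)) (∀E (trL U) (mainTheorem16 d))
mainTheorem16 (m {Θ = Θ} {μ = μ} xs x unique fresh x-fresh x-unbound d e) =
  m-uniform (trM μ) xs x unique (All.map (mapCtx-fresh trM Θ) fresh) (mapCtx-fresh trM Θ x-fresh)
    x-unbound (transport (mapCtx-extendMany trM Θ μ (toList xs)) (mainTheorem16 d))
    (≐-trans (mapCtx-cong trM e) (mapCtx-extend trM Θ x (! μ)))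
mainTheorem16 (sp {Θ = Θ} d e) =
  st-single (mainTheorem16 d) (≐-trans (mapCtx-cong trM e) (mapCtx-square (λ _ → refl) Θ))
mainTheorem16 (α d p) = α (mainTheorem16 d) p
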